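{- Let $n\ge1$ and $(m_1,\dots,m_n)$ a sequence of positive integers. The number $R(m_1,\dots,m_n)$ does not depend on the choice of $m_1$. Moreover, for every positive integer $m$, $L(m)=R(m)=1$.
   Context: $\mathcal{A}_n=\{1<\cdots<n\}$. A composition diagram is a finite left-to-right sequence of nonempty bottom-justified columns of boxes; the bottom row consists of the lowest boxes. An lps tableau over $\mathcal{A}_n$: filling by elements of $\mathcal{A}_n$ with columns strictly increasing bottom to top and bottom row weakly increasing left to right. An rps tableau: columns weakly increasing bottom to top and bottom row strictly increasing left to right. $L(m_1,\dots,m_n)$ (resp. $R(m_1,\dots,m_n)$) denotes the number of lps (resp. rps) tableaux over $\mathcal{A}_n$ in which each symbol $a$ occurs exactly $m_a$ times. -}

module Defs where

open import Data.Nat using (ℕ; suc)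
open import Data.Fin using (Fin) renaming (_<_ to _<ᶠ_; _≤_ to _≤ᶠ_; _≟_ to _≟ᶠ_)
open import Data.List using (List; map; concatMap; filter; length)
open import Data.List.NonEmpty using (List⁺; toList; head)
open import Data.List.Relation.Unary.All using (All)
open import Data.List.Relation.Unary.Linked using (Linked)
open import Data.List.Relation.Unary.Unique.Propositional using (Unique)
open import Data.List.Membership.Propositional using (_∈_)
open import Data.Product using (Σ; _×_)
open import Function.Bundles using (_⇔_)
open import Relation.Binary.PropositionalEquality using (_≡_)

-- A column: nonempty list of symbols, listed from bottom to top.
Column : ℕ → Set
Column n = List⁺ (Fin n)

-- A filling of a composition diagram: list of columns, left to right.
-- (Every column is nonempty; the diagram shape is determined by the column lengths.)
Tableau : ℕ → Set
Tableau n = List (Column n)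

bottomRow : ∀ {n} → Tableau n → List (Fin n)
bottomRow = map head

entries : ∀ {n} → Tableau n → List (Fin n)
entries = concatMap toList

occ : ∀ {n} → Fin n → Tableau n → ℕ
occ a T = length (filter (_≟ᶠ a) (entries T))

HasContent : ∀ {n} → (Fin n → ℕ) → Tableau n → Set
HasContent m T = ∀ a → occ a T ≡ m a

IsLps : ∀ {n} → Tableau n → Set
IsLps T = All (λ c → Linked _<ᶠ_ (toList c)) T × Linked _≤ᶠ_ (bottomRow T)

IsRps : ∀ {n} → Tableau n → Set
IsRps T = All (λ c → Linked _≤ᶠ_ (toList c)) T × Linked _<ᶠ_ (bottomRow T)

HasCard : ∀ {n} → (Tableau n → Set) → ℕ → Set
HasCard {n} P k =
  Σ (List (Tableau n)) λ xs → length xs ≡ k × Unique xs × (∀ T → (P T ⇔ (T ∈ xs)))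

L≡ : ∀ {n} → (Fin n → ℕ) → ℕ → Set
L≡ m k = HasCard (λ T → IsLps T × HasContent m T) k

R≡ : ∀ {n} → (Fin n → ℕ) → ℕ → Set
R≡ m k = HasCard (λ T → IsRps T × HasContent m T) k

-- In an rps tableau the bottom row is strictly increasing and columns weakly increase, so the
-- symbol 1 can only occur as the run at the bottom of the first column, and every other entry is
-- larger than 1. Hence resizing that run is a bijection between rps tableaux of contents
-- (m₁, m₂, …, mₙ) and (m₁′, m₂, …, mₙ), which shows that R does not depend on m₁ (R is finite since
-- a tableau of content m has m₁ + ⋯ + mₙ boxes). Over a single symbol, strictly increasing columns
-- force single boxes and a strictly increasing bottom row forces a single column, so the unique lps
-- tableau is a row of m boxes and the unique rps tableau a column of m boxes.
module Submission where

open import Defs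
open import Data.Nat using (ℕ; suc; _≤_)
open import Data.Fin using (Fin)
open import Data.Product using (Σ; _×_)
open import Relation.Binary.PropositionalEquality using (_≡_)

open import Data.Nat as ℕ using (zero; _+_; z≤n; s≤s)
import Data.Nat.Properties as ℕP
open import Data.Fin as F using () renaming (_<_ to _<ᶠ_; _≤_ to _≤ᶠ_)
open import Data.Fin.Properties as FP using (_≟_)
open import Data.List using (List; []; _∷_; [_]; _++_; map; concatMap; filter; length; replicate;
  takeWhile; dropWhile; allFin; deduplicate)
open import Data.List.Properties as LP using (length-++; filter-++; filter-none; ++-assoc; length-map;
  map-∘; map-id-local; takeWhile++dropWhile)
open import Data.List.NonEmpty as List⁺ using (toList; head) renaming (_∷_ to _∷⁺_)
open import Data.List.Relation.Unary.All as All using (All; []; _∷_)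
open import Data.List.Relation.Unary.All.Properties as AllP using (all-takeWhile)
open import Data.List.Relation.Unary.Any as Any using (here; there)
open import Data.List.Relation.Unary.Linked as Linked using (Linked; []; [-]; _∷_)
open import Data.List.Relation.Unary.Linked.Properties using (Linked⇒All)
import Data.List.Relation.Unary.AllPairs as AllPairs
open import Data.List.Relation.Unary.Unique.Propositional using (Unique)
import Data.List.Relation.Unary.Unique.Propositional.Properties as Unique
open import Data.List.Relation.Unary.Unique.DecPropositional.Properties using (deduplicate-!)
open import Data.List.Membership.Propositional using (_∈_)
open import Data.List.Membership.Propositional.Properties using (∈-map⁺; ∈-map⁻; ∈-concatMap⁺;
  ∈-allFin; ∈-filter⁺; ∈-filter⁻; ∈-deduplicate⁺; ∈-deduplicate⁻)
open import Data.Product using (_,_; proj₂; ∃)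
open import Relation.Binary.PropositionalEquality using (_≢_; refl; sym; trans; cong; cong₂; subst; module ≡-Reasoning)
open import Relation.Binary.Definitions using (DecidableEquality)
open import Relation.Nullary using (yes; no; contradiction)
open import Relation.Nullary.Decidable using (_×-dec_; map′)
open import Relation.Unary using (Decidable)
open import Function.Base using (_∘_)
open import Function.Bundles using (mk⇔; Equivalence)
open import Algebra.Properties.CommutativeMonoid.Sum ℕP.+-0-commutativeMonoid
  using (sum; sum-cong-≗; ∑-distrib-+; sum-replicate-zero)

All-≡⇒replicate : ∀ {A : Set} {x : A} {xs} → All (_≡ x) xs → xs ≡ replicate (length xs) x
All-≡⇒replicate [] = refl
All-≡⇒replicate (refl ∷ eqs) = cong (_ ∷_) (All-≡⇒replicate eqs)

toList-injective : ∀ {A : Set} {c d : List⁺.List⁺ A} → toList c ≡ toList d → c ≡ d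
toList-injective {c = _ ∷⁺ _} {_ ∷⁺ _} refl = refl

column-≟ : ∀ {n} → DecidableEquality (Column n)
column-≟ c d = map′ toList-injective (cong toList) (LP.≡-dec _≟_ (toList c) (toList d))

tableau-≟ : ∀ {n} → DecidableEquality (Tableau n)
tableau-≟ = LP.≡-dec column-≟

count : ∀ {n} → Fin n → List (Fin n) → ℕ
count a xs = length (filter (_≟ a) xs)

count-++ : ∀ {n} (a : Fin n) xs ys → count a (xs ++ ys) ≡ count a xs + count a ys
count-++ a xs ys = trans (cong length (filter-++ (_≟ a) xs ys)) (length-++ (filter (_≟ a) xs))

count-suc-[_] : ∀ {n} (x : Fin n) a → count (F.suc a) [ F.suc x ] ≡ count a [ x ]
count-suc-[ x ] a with x ≟ a
... | yes _ = refl
... | no _ = refl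

sum-count-[_] : ∀ {n} (x : Fin n) → sum (λ a → count a [ x ]) ≡ 1
sum-count-[_] {suc n} F.zero = cong suc (sum-replicate-zero n)
sum-count-[_] {suc n} (F.suc x) = trans (sum-cong-≗ (count-suc-[ x ])) sum-count-[ x ]

length≡sum-count : ∀ {n} (xs : List (Fin n)) → length xs ≡ sum (λ a → count a xs)
length≡sum-count {n} [] = sym (sum-replicate-zero n)
length≡sum-count {n} (x ∷ xs) = begin
  1 + length xs
    ≡⟨ cong₂ _+_ (sym sum-count-[ x ]) (length≡sum-count xs) ⟩
  sum (λ a → count a [ x ]) + sum (λ a → count a xs)
    ≡⟨ sym (∑-distrib-+ {n} _ _) ⟩
  sum (λ a → count a [ x ] + count a xs)
    ≡⟨ sum-cong-≗ (λ a → sym (count-++ a [ x ] xs)) ⟩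
  sum (λ a → count a (x ∷ xs))
    ∎
  where open ≡-Reasoning

length-entries≡sum : ∀ {n} {m : Fin n → ℕ} {T} → HasContent m T → length (entries T) ≡ sum m
length-entries≡sum {T = T} h = trans (length≡sum-count (entries T)) (sum-cong-≗ h)

listsUpTo : ∀ {A : Set} → List A → ℕ → List (List A)
listsUpTo E zero = [ [] ]
listsUpTo E (suc k) = [] ∷ concatMap (λ x → map (x ∷_) (listsUpTo E k)) E

∈-listsUpTo : ∀ {A : Set} {E : List A} k {xs} → length xs ≤ k → All (_∈ E) xs → xs ∈ listsUpTo E k
∈-listsUpTo zero {[]} _ _ = here refl
∈-listsUpTo (suc k) {[]} _ _ = here refl
∈-listsUpTo {E = E} (suc k) {x ∷ xs} (s≤s len) (x∈E ∷ xs⊆E) =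
  there (∈-concatMap⁺ (λ y → map (y ∷_) (listsUpTo E k))
    (Any.map (λ { refl → ∈-map⁺ (x ∷_) (∈-listsUpTo k len xs⊆E) }) x∈E))

columnsUpTo : (n : ℕ) → ℕ → List (Column n)
columnsUpTo n k = concatMap (λ x → map (x ∷⁺_) (listsUpTo (allFin n) k)) (allFin n)

∈-columnsUpTo : ∀ {n} k (c : Column n) → length (toList c) ≤ suc k → c ∈ columnsUpTo n k
∈-columnsUpTo {n} k (x ∷⁺ xs) (s≤s len) =
  ∈-concatMap⁺ (λ y → map (y ∷⁺_) (listsUpTo (allFin n) k))
    (Any.map (λ { refl → ∈-map⁺ (x ∷⁺_) (∈-listsUpTo k len (All.universal ∈-allFin xs)) })
      (∈-allFin x))

tableauxUpTo : (n : ℕ) → ℕ → List (Tableau n)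
tableauxUpTo n k = listsUpTo (columnsUpTo n k) k

∈-tableauxUpTo : ∀ {n} k (T : Tableau n) → length (entries T) ≤ k → T ∈ tableauxUpTo n k
∈-tableauxUpTo k T len = ∈-listsUpTo k (ℕP.≤-trans (length≤length-entries T) len) (columns∈ T len)
  where
  length≤length-entries : ∀ {n} (T : Tableau n) → length T ≤ length (entries T)
  length≤length-entries [] = z≤n
  length≤length-entries ((x ∷⁺ xs) ∷ T) =
    s≤s (ℕP.≤-trans (length≤length-entries T) (LP.length-++-≤ʳ (entries T) {xs}))
  columns∈ : ∀ T → length (entries T) ≤ k → All (_∈ columnsUpTo _ k) T
  columns∈ [] _ = []
  columns∈ (c ∷ T) len =
    ∈-columnsUpTo k c (ℕP.≤-trans (LP.length-++-≤ˡ (toList c)) (ℕP.≤-trans len (ℕP.n≤1+n k)))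
    ∷ columns∈ T (ℕP.≤-trans (LP.length-++-≤ʳ (entries T) {toList c}) len)

hasCard-⊆ : ∀ {n} {P : Tableau n → Set} → Decidable P → (xs : List (Tableau n)) →
  (∀ {T} → P T → T ∈ xs) → ∃ (HasCard P)
hasCard-⊆ P? xs P⊆xs =
  length ys , ys , refl , deduplicate-! tableau-≟ (filter P? xs) , λ T → mk⇔
    (λ p → ∈-deduplicate⁺ tableau-≟ (∈-filter⁺ P? (P⊆xs p) p))
    (λ T∈ys → proj₂ (∈-filter⁻ P? {xs = xs} (∈-deduplicate⁻ tableau-≟ (filter P? xs) T∈ys)))
  where
  ys = deduplicate tableau-≟ (filter P? xs)

isRps? : ∀ {n} → Decidable (IsRps {n})
isRps? T =
  All.all? (λ c → Linked.linked? FP._≤?_ (toList c)) T ×-dec Linked.linked? FP._<?_ (bottomRow T)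

hasContent? : ∀ {n} (m : Fin n → ℕ) → Decidable (HasContent m)
hasContent? m T = FP.all? (λ a → occ a T ℕ.≟ m a)

R-finite : ∀ {n} (m : Fin n → ℕ) → ∃ (R≡ m)
R-finite {n} m = hasCard-⊆ (λ T → isRps? T ×-dec hasContent? m T) (tableauxUpTo n (sum m))
  λ { {T} (_ , h) → ∈-tableauxUpTo (sum m) T (ℕP.≤-reflexive (length-entries≡sum {m = m} {T} h)) }

hasCard-transport : ∀ {n} {P Q : Tableau n → Set} {k} (f g : Tableau n → Tableau n) →
  (∀ {T} → P T → Q (f T)) → (∀ {T} → Q T → P (g T)) →
  (∀ {T} → P T → g (f T) ≡ T) → (∀ {T} → Q T → f (g T) ≡ T) →
  HasCard P k → HasCard Q k
hasCard-transport {P = P} {Q} f g f-QP g-QP gf≡id fg≡id (xs , len , xs! , P⇔∈xs) =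
  map f xs , trans (length-map f xs) len , Unique.map⁻ {f = g} (subst Unique (sym g∘f≡id) xs!) ,
  λ T → mk⇔ Q⇒∈ (∈⇒Q T)
  where
  P-xs : All P xs
  P-xs = All.tabulate λ {T} → Equivalence.from (P⇔∈xs T)
  g∘f≡id : map g (map f xs) ≡ xs
  g∘f≡id = trans (sym (map-∘ xs)) (map-id-local (All.map gf≡id P-xs))
  Q⇒∈ : ∀ {T} → Q T → T ∈ map f xs
  Q⇒∈ {T} q = subst (_∈ map f xs) (fg≡id q) (∈-map⁺ f (Equivalence.to (P⇔∈xs (g T)) (g-QP q)))
  ∈⇒Q : ∀ T → T ∈ map f xs → Q T
  ∈⇒Q T T∈ with ∈-map⁻ f T∈
  ... | U , U∈xs , refl = f-QP (Equivalence.from (P⇔∈xs U) U∈xs)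

module _ {n : ℕ} where

  private
    Symbol = Fin (suc n)
    0ˢ : Symbol
    0ˢ = F.zero

  nonzero-≤ : ∀ {x y : Symbol} → x ≢ 0ˢ → x ≤ᶠ y → y ≢ 0ˢ
  nonzero-≤ {F.zero} x≢0 _ _ = x≢0 refl
  nonzero-≤ {F.suc _} _ () refl

  nonzero-> : ∀ {x y : Symbol} → x <ᶠ y → y ≢ 0ˢ
  nonzero-> () refl

  weakly-increasing-nonzero : ∀ {x xs} → Linked _≤ᶠ_ (x ∷ xs) → x ≢ 0ˢ → All (_≢ 0ˢ) (x ∷ xs)
  weakly-increasing-nonzero inc x≢0 = All.map (nonzero-≤ x≢0) (Linked⇒All FP.≤-trans FP.≤-refl inc)

  strictly-increasing-tail-nonzero : ∀ {x ys} → Linked _<ᶠ_ (x ∷ ys) → All (_≢ 0ˢ) ys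
  strictly-increasing-tail-nonzero [-] = []
  strictly-increasing-tail-nonzero (x<y ∷ inc) = nonzero-> x<y ∷ strictly-increasing-tail-nonzero inc

  dropZeros : List Symbol → List Symbol
  dropZeros = dropWhile (_≟ 0ˢ)

  dropZeros-nonzero : ∀ {xs} → Linked _≤ᶠ_ xs → All (_≢ 0ˢ) (dropZeros xs)
  dropZeros-nonzero {[]} _ = []
  dropZeros-nonzero {x ∷ xs} inc with x ≟ 0ˢ
  ... | yes _ = dropZeros-nonzero (Linked.tail inc)
  ... | no x≢0 = weakly-increasing-nonzero inc x≢0

  dropZeros-increasing : ∀ {xs} → Linked _≤ᶠ_ xs → Linked _≤ᶠ_ (dropZeros xs)
  dropZeros-increasing {[]} inc = inc
  dropZeros-increasing {x ∷ xs} inc with x ≟ 0ˢ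
  ... | yes _ = dropZeros-increasing (Linked.tail inc)
  ... | no _ = inc

  dropZeros-∷ : ∀ {x} xs → x ≢ 0ˢ → dropZeros (x ∷ xs) ≡ x ∷ xs
  dropZeros-∷ {x} _ x≢0 with x ≟ 0ˢ
  ... | yes x≡0 = contradiction x≡0 x≢0
  ... | no _ = refl

  dropZeros-idem : ∀ xs → dropZeros (dropZeros xs) ≡ dropZeros xs
  dropZeros-idem [] = refl
  dropZeros-idem (x ∷ xs) with x ≟ 0ˢ
  ... | yes _ = dropZeros-idem xs
  ... | no x≢0 = dropZeros-∷ xs x≢0

  dropZeros-replicate : ∀ k xs → dropZeros (replicate k 0ˢ ++ xs) ≡ dropZeros xs
  dropZeros-replicate zero xs = refl
  dropZeros-replicate (suc k) xs = dropZeros-replicate k xs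

  zeros++dropZeros : ∀ xs → xs ≡ replicate (length (takeWhile (_≟ 0ˢ) xs)) 0ˢ ++ dropZeros xs
  zeros++dropZeros xs = trans (sym (takeWhile++dropWhile (_≟ 0ˢ) xs))
    (cong (_++ dropZeros xs) (All-≡⇒replicate (all-takeWhile (_≟ 0ˢ) xs)))

  zeros-increasing : ∀ k {xs} → Linked _≤ᶠ_ xs → Linked _≤ᶠ_ (replicate k 0ˢ ++ xs)
  zeros-increasing zero inc = inc
  zeros-increasing (suc k) inc = zero-∷ (zeros-increasing k inc)
    where
    zero-∷ : ∀ {xs} → Linked _≤ᶠ_ xs → Linked _≤ᶠ_ (0ˢ ∷ xs)
    zero-∷ [] = [-]
    zero-∷ [-] = z≤n ∷ [-]
    zero-∷ (x≤y ∷ inc′) = z≤n ∷ x≤y ∷ inc′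

  count-zero-replicate : ∀ k {xs} → All (_≢ 0ˢ) xs → count 0ˢ (replicate k 0ˢ ++ xs) ≡ k
  count-zero-replicate zero nonzero = cong length (filter-none (_≟ 0ˢ) nonzero)
  count-zero-replicate (suc k) nonzero = cong suc (count-zero-replicate k nonzero)

  count-suc-replicate : ∀ k a xs → count (F.suc a) (replicate k 0ˢ ++ xs) ≡ count (F.suc a) xs
  count-suc-replicate zero a xs = refl
  count-suc-replicate (suc k) a xs = count-suc-replicate k a xs

  zeroRun : Tableau (suc n) → ℕ
  zeroRun [] = 0
  zeroRun (c ∷ _) = length (takeWhile (_≟ 0ˢ) (toList c))

  nonzeroEntries : Tableau (suc n) → List Symbol
  nonzeroEntries [] = []
  nonzeroEntries (c ∷ T) = dropZeros (toList c) ++ entries T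

  entries-zeroRun : ∀ T → entries T ≡ replicate (zeroRun T) 0ˢ ++ nonzeroEntries T
  entries-zeroRun [] = refl
  entries-zeroRun (c ∷ T) = trans (cong (_++ entries T) (zeros++dropZeros (toList c)))
    (++-assoc (replicate (zeroRun (c ∷ T)) 0ˢ) (dropZeros (toList c)) (entries T))

  nonzeroEntries-rps : ∀ {T} → IsRps T → All (_≢ 0ˢ) (nonzeroEntries T)
  nonzeroEntries-rps {[]} _ = []
  nonzeroEntries-rps {c ∷ T} (inc ∷ incs , bottom) =
    AllP.++⁺ (dropZeros-nonzero inc)
      (entries-nonzero incs (AllP.map⁻ (strictly-increasing-tail-nonzero bottom)))
    where
    entries-nonzero : ∀ {T} → All (λ c → Linked _≤ᶠ_ (toList c)) T → All (λ c → head c ≢ 0ˢ) T →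
      All (_≢ 0ˢ) (entries T)
    entries-nonzero [] [] = []
    entries-nonzero (inc ∷ incs) (h≢0 ∷ hs≢0) =
      AllP.++⁺ (weakly-increasing-nonzero inc h≢0) (entries-nonzero incs hs≢0)

  occ-zero-rps : ∀ {T} → IsRps T → occ 0ˢ T ≡ zeroRun T
  occ-zero-rps {T} rps = trans (cong (count 0ˢ) (entries-zeroRun T))
    (count-zero-replicate (zeroRun T) (nonzeroEntries-rps rps))

  -- The new first column starts with suc j zeros, so that it stays nonempty.
  setZeroRun : ℕ → Tableau (suc n) → Tableau (suc n)
  setZeroRun j [] = []
  setZeroRun j (c ∷ T) = (0ˢ ∷⁺ (replicate j 0ˢ ++ dropZeros (toList c))) ∷ T

  entries-setZeroRun : ∀ j c T →
    entries (setZeroRun j (c ∷ T)) ≡ replicate (suc j) 0ˢ ++ nonzeroEntries (c ∷ T)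
  entries-setZeroRun j c T = cong (0ˢ ∷_) (++-assoc (replicate j 0ˢ) (dropZeros (toList c)) (entries T))

  setZeroRun-setZeroRun : ∀ j j′ T → setZeroRun j (setZeroRun j′ T) ≡ setZeroRun j T
  setZeroRun-setZeroRun j j′ [] = refl
  setZeroRun-setZeroRun j j′ (c ∷ T) = cong (λ xs → (0ˢ ∷⁺ (replicate j 0ˢ ++ xs)) ∷ T)
    (trans (dropZeros-replicate (suc j′) (dropZeros (toList c))) (dropZeros-idem (toList c)))

  setZeroRun-zeroRun : ∀ {j} T → zeroRun T ≡ suc j → setZeroRun j T ≡ T
  setZeroRun-zeroRun (c ∷ T) run≡ = cong (_∷ T) (toList-injective (sym (trans
    (zeros++dropZeros (toList c)) (cong (λ k → replicate k 0ˢ ++ dropZeros (toList c)) run≡))))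

  setZeroRun-rps : ∀ j {T} → IsRps T → IsRps (setZeroRun j T)
  setZeroRun-rps j {[]} rps = rps
  setZeroRun-rps j {c ∷ T} (inc ∷ incs , bottom) =
    (zeros-increasing (suc j) (dropZeros-increasing inc) ∷ incs) , lower-bottom bottom
    where
    lower-bottom : ∀ {x ys} → Linked _<ᶠ_ (x ∷ ys) → Linked _<ᶠ_ (0ˢ ∷ ys)
    lower-bottom [-] = [-]
    lower-bottom (x<y ∷ inc) = ℕP.≤-trans (s≤s z≤n) x<y ∷ inc

  occ-zero-setZeroRun : ∀ j {c T} → IsRps (c ∷ T) → occ 0ˢ (setZeroRun j (c ∷ T)) ≡ suc j
  occ-zero-setZeroRun j {c} {T} rps = trans (cong (count 0ˢ) (entries-setZeroRun j c T))
    (count-zero-replicate (suc j) (nonzeroEntries-rps rps))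

  occ-suc-setZeroRun : ∀ j a T → occ (F.suc a) (setZeroRun j T) ≡ occ (F.suc a) T
  occ-suc-setZeroRun j a [] = refl
  occ-suc-setZeroRun j a (c ∷ T) = begin
    count b (entries (setZeroRun j (c ∷ T)))
      ≡⟨ cong (count b) (entries-setZeroRun j c T) ⟩
    count b (replicate (suc j) 0ˢ ++ nonzeroEntries (c ∷ T))
      ≡⟨ count-suc-replicate (suc j) a _ ⟩
    count b (nonzeroEntries (c ∷ T))
      ≡⟨ count-suc-replicate (zeroRun (c ∷ T)) a _ ⟨
    count b (replicate (zeroRun (c ∷ T)) 0ˢ ++ nonzeroEntries (c ∷ T))
      ≡⟨ cong (count b) (entries-zeroRun (c ∷ T)) ⟨
    count b (entries (c ∷ T))
      ∎
    where
    open ≡-Reasoning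
    b = F.suc a

RpsWithContent : ∀ {n} → (Fin n → ℕ) → Tableau n → Set
RpsWithContent m T = IsRps T × HasContent m T

setZeroRun-content : ∀ {n} {m m′ : Fin (suc n) → ℕ} {j T} → (∀ a → m (F.suc a) ≡ m′ (F.suc a)) →
  1 ≤ m F.zero → m′ F.zero ≡ suc j → RpsWithContent m T → RpsWithContent m′ (setZeroRun j T)
setZeroRun-content {T = []} _ 1≤m₀ _ (_ , content) with subst (1 ≤_) (sym (content F.zero)) 1≤m₀
... | ()
setZeroRun-content {j = j} {c ∷ T} agree _ m′₀≡ (rps , content) = setZeroRun-rps j rps , λ where
  F.zero → trans (occ-zero-setZeroRun j rps) (sym m′₀≡)
  (F.suc a) → trans (occ-suc-setZeroRun j a (c ∷ T)) (trans (content (F.suc a)) (agree a))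

setZeroRun-fixes : ∀ {n} {m : Fin (suc n) → ℕ} {j T} →
  m F.zero ≡ suc j → RpsWithContent m T → setZeroRun j T ≡ T
setZeroRun-fixes {T = T} m₀≡ (rps , content) =
  setZeroRun-zeroRun T (trans (sym (occ-zero-rps rps)) (trans (content F.zero) m₀≡))

R-independent-of-first-multiplicity : (n : ℕ) → (m m′ : Fin (suc n) → ℕ) →
  (∀ i → 1 ≤ m i) → (∀ i → 1 ≤ m′ i) → (∀ (i : Fin n) → m (F.suc i) ≡ m′ (F.suc i)) →
  Σ ℕ λ k → R≡ m k × R≡ m′ k
R-independent-of-first-multiplicity n m m′ 1≤m 1≤m′ agree =
  let k , R≡k = R-finite m in
  k , R≡k , hasCard-transport (setZeroRun j′) (setZeroRun j)
    (setZeroRun-content agree (1≤m F.zero) m′₀≡)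
    (setZeroRun-content (sym ∘ agree) (1≤m′ F.zero) m₀≡)
    (λ {T} p → trans (setZeroRun-setZeroRun j j′ T) (setZeroRun-fixes m₀≡ p))
    (λ {T} q → trans (setZeroRun-setZeroRun j′ j T) (setZeroRun-fixes m′₀≡ q))
    R≡k
  where
  j = ℕ.pred (m F.zero)
  j′ = ℕ.pred (m′ F.zero)
  m₀≡ : m F.zero ≡ suc j
  m₀≡ = sym (ℕP.suc-pred (m F.zero) {{ℕ.>-nonZero (1≤m F.zero)}})
  m′₀≡ : m′ F.zero ≡ suc j′
  m′₀≡ = sym (ℕP.suc-pred (m′ F.zero) {{ℕ.>-nonZero (1≤m′ F.zero)}})

hasCard-unique : ∀ {n} {P : Tableau n → Set} (T₀ : Tableau n) →
  P T₀ → (∀ {T} → P T → T ≡ T₀) → HasCard P 1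
hasCard-unique T₀ p unique =
  [ T₀ ] , refl , [] AllPairs.∷ AllPairs.[] , λ T → mk⇔ (λ q → here (unique q)) λ { (here refl) → p }

Fin1-zero : (x : Fin 1) → x ≡ F.zero
Fin1-zero F.zero = refl

Fin1-weakly-increasing : (xs : List (Fin 1)) → Linked _≤ᶠ_ xs
Fin1-weakly-increasing [] = []
Fin1-weakly-increasing (_ ∷ []) = [-]
Fin1-weakly-increasing (F.zero ∷ y ∷ xs) = z≤n ∷ Fin1-weakly-increasing (y ∷ xs)

Fin1-strictly-increasing-column : {c : Column 1} → Linked _<ᶠ_ (toList c) → c ≡ F.zero ∷⁺ []
Fin1-strictly-increasing-column {F.zero ∷⁺ []} [-] = refl
Fin1-strictly-increasing-column {F.zero ∷⁺ F.zero ∷ _} (() ∷ _)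

occ-Fin1 : (T : Tableau 1) → occ F.zero T ≡ length (entries T)
occ-Fin1 T = cong length (LP.filter-all (_≟ F.zero) (All.universal Fin1-zero (entries T)))

row : ℕ → Tableau 1
row k = replicate k (F.zero ∷⁺ [])

occ-row : ∀ k → occ F.zero (row k) ≡ k
occ-row zero = refl
occ-row (suc k) = cong suc (occ-row k)

column : ℕ → Tableau 1
column k = [ F.zero ∷⁺ replicate k F.zero ]

length-column : ∀ (xs : List (Fin 1)) → length (entries [ F.zero ∷⁺ xs ]) ≡ suc (length xs)
length-column xs = cong (suc ∘ length) (LP.++-identityʳ xs)

occ-column : ∀ k → occ F.zero (column k) ≡ suc k
occ-column k = trans (occ-Fin1 (column k))
  (trans (length-column (replicate k F.zero)) (cong suc (LP.length-replicate k)))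

L-single-symbol : ∀ m → L≡ {1} (λ _ → m) 1
L-single-symbol m =
  hasCard-unique (row m) ((AllP.replicate⁺ m [-] , Fin1-weakly-increasing _) , λ { F.zero → occ-row m }) unique
  where
  unique : ∀ {T} → IsLps T × HasContent (λ _ → m) T → T ≡ row m
  unique {T} ((strict , _) , content) = begin
    T              ≡⟨ T≡row ⟩
    row (length T) ≡⟨ cong row length≡m ⟩
    row m          ∎
    where
    open ≡-Reasoning
    T≡row : T ≡ row (length T)
    T≡row = All-≡⇒replicate (All.map Fin1-strictly-increasing-column strict)
    length≡m : length T ≡ m
    length≡m = trans (sym (occ-row (length T))) (trans (cong (occ F.zero) (sym T≡row)) (content F.zero))

R-single-symbol : ∀ m → 1 ≤ m → R≡ {1} (λ _ → m) 1
R-single-symbol (suc k) _ =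
  hasCard-unique (column k)
    ((Fin1-weakly-increasing _ ∷ [] , [-]) , λ { F.zero → occ-column k })
    unique
  where
  unique : ∀ {T} → IsRps T × HasContent (λ _ → suc k) T → T ≡ column k
  unique {[]} (_ , content) with content F.zero
  ... | ()
  unique {(F.zero ∷⁺ _) ∷ (F.zero ∷⁺ _) ∷ _} ((_ , () ∷ _) , _)
  unique {T@((F.zero ∷⁺ xs) ∷ [])} (_ , content) =
    cong (λ ys → [ F.zero ∷⁺ ys ]) (trans (replicate-Fin1 xs) (cong (λ l → replicate l F.zero) length-xs))
    where
    replicate-Fin1 : (ys : List (Fin 1)) → ys ≡ replicate (length ys) F.zero
    replicate-Fin1 ys = All-≡⇒replicate (All.universal Fin1-zero ys)
    length-xs : length xs ≡ k
    length-xs = ℕP.suc-injective (trans (sym (length-column xs)) (trans (sym (occ-Fin1 T)) (content F.zero)))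

lemma4p4 : ((n : ℕ) → (m m′ : Fin (suc n) → ℕ) →
    (∀ i → 1 ≤ m i) → (∀ i → 1 ≤ m′ i) →
    (∀ (i : Fin n) → m (Fin.suc i) ≡ m′ (Fin.suc i)) →
    Σ ℕ λ k → R≡ m k × R≡ m′ k)
    × ((m : ℕ) → 1 ≤ m →
    L≡ {1} (λ _ → m) 1 × R≡ {1} (λ _ → m) 1)
lemma4p4 = R-independent-of-first-multiplicity , λ m 1≤m → L-single-symbol m , R-single-symbol m 1≤m
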